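{- For disjunctive systems and every $n \geq 1$: $$(A,B)^{(1,n)} \models \mathsf{E}_{uncond}\, h(A,B_1) \;\Longrightarrow\; (A,B)^{(1,n+1)} \models \mathsf{E}_{uncond}\, h(A,B_1).$$
   Context: A process template is a transition system $U=(Q_U,\mathit{init}_U,\Sigma_U,\delta_U)$ with finite state set $Q_U$, initial state $\mathit{init}_U$, input alphabet $\Sigma_U$ and guarded transition relation $\delta_U \subseteq Q_U\times\Sigma_U\times 2^{Q_A\cup Q_B}\times Q_U$. The system $(A,B)^{(1,n)}$ is the interleaving parallel composition of one copy of template $A$ and $n$ copies $B_1,\dots,B_n$ of template $B$: in each step exactly one process takes a local transition whose guard $g$ is satisfied. In a disjunctive system, the guard $g$ of a transition of process $p$ is satisfied iff some process other than $p$ is currently in a local state belonging to $g$. The environment keeps the input to a process unchanged until that process moves. A run is a maximal path from the initial global state $(\mathit{init}_A,\mathit{init}_B,\dots,\mathit{init}_B)$; a run is unconditionally fair if it is infinite and every process moves infinitely often. $h(A,B_1)$ is an LTL formula without the next-time operator $\mathsf{X}$, over the local states and inputs of process $A$ and process $B_1$. $\mathsf{E}_{uncond}\, h(A,B_1)$ holds in a system iff there exists an unconditionally fair run satisfying $h(A,B_1)$. -}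

module Defs where

open import Data.Nat using (ℕ; zero; suc; _≤_; _<_)
open import Data.Fin using (Fin) renaming (zero to fzero)
open import Data.Fin.Subset using (Subset; _∈_)
open import Data.Product using (Σ; ∃; _×_; _,_; proj₁; proj₂)
open import Data.Sum using (_⊎_)
open import Data.Empty using (⊥)
open import Data.Unit using (⊤)
open import Relation.Binary.PropositionalEquality using (_≡_; _≢_)

-- A guard is a subset of Q_A ∪ Q_B (disjoint union), represented as a
-- pair of subsets.

Guard : ℕ → ℕ → Set
Guard qa qb = Subset qa × Subset qb

record Template (nQ nΣ qa qb : ℕ) : Set₁ where
  field
    init : Fin nQ
    δ    : Fin nQ → Fin nΣ → Guard qa qb → Fin nQ → Set

open Template public

record Config (qa qb sa sb n : ℕ) : Set where
  field
    stA : Fin qa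
    inA : Fin sa
    stB : Fin n → Fin qb
    inB : Fin n → Fin sb

open Config public

data Proc (n : ℕ) : Set where
  pA : Proc n
  pB : Fin n → Proc n

module _ {qa qb sa sb : ℕ} (A : Template qa sa qa qb) (B : Template qb sb qa qb) where

  -- disjunctive guard satisfaction: some process OTHER than the mover is
  -- in a local state belonging to g
  guardOkA : ∀ {n} → Guard qa qb → Config qa qb sa sb n → Set
  guardOkA g c = ∃ λ j → stB c j ∈ proj₂ g

  guardOkB : ∀ {n} → Guard qa qb → Config qa qb sa sb n → Fin n → Set
  guardOkB g c i = (stA c ∈ proj₁ g) ⊎ (∃ λ j → j ≢ i × stB c j ∈ proj₂ g)

  -- The mover reads its current input; its new input is arbitrary
  -- (chosen by the environment); all other processes keep their local
  -- state and input.
  Step : ∀ {n} → Config qa qb sa sb n → Proc n → Config qa qb sa sb n → Set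
  Step c pA c' =
    (∃ λ g → δ A (stA c) (inA c) g (stA c') × guardOkA g c)
    × (∀ j → stB c' j ≡ stB c j) × (∀ j → inB c' j ≡ inB c j)
  Step c (pB i) c' =
    (∃ λ g → δ B (stB c i) (inB c i) g (stB c' i) × guardOkB g c i)
    × stA c' ≡ stA c × inA c' ≡ inA c
    × (∀ j → j ≢ i → stB c' j ≡ stB c j)
    × (∀ j → j ≢ i → inB c' j ≡ inB c j)

  -- initial global states: every process in its initial local state;
  -- the initial inputs are arbitrary
  Initial : ∀ {n} → Config qa qb sa sb n → Set
  Initial c = stA c ≡ init A × (∀ j → stB c j ≡ init B)

  record InfRun (n : ℕ) : Set where
    field
      conf  : ℕ → Config qa qb sa sb n
      mover : ℕ → Proc n
      start : Initial (conf 0)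
      steps : ∀ t → Step (conf t) (mover t) (conf (suc t))

  open InfRun public

  UncondFair : ∀ {n} → InfRun n → Set
  UncondFair {n} r = ∀ (p : Proc n) (t : ℕ) → ∃ λ t' → t ≤ t' × mover r t' ≡ p

data Atom (qa qb sa sb : ℕ) : Set where
  atStA : Fin qa → Atom qa qb sa sb
  atInA : Fin sa → Atom qa qb sa sb
  atStB : Fin qb → Atom qa qb sa sb
  atInB : Fin sb → Atom qa qb sa sb

data LTL (qa qb sa sb : ℕ) : Set where
  true  : LTL qa qb sa sb
  atom  : Atom qa qb sa sb → LTL qa qb sa sb
  ¬L_   : LTL qa qb sa sb → LTL qa qb sa sb
  _∧L_  : LTL qa qb sa sb → LTL qa qb sa sb → LTL qa qb sa sb
  _UL_  : LTL qa qb sa sb → LTL qa qb sa sb → LTL qa qb sa sb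

Letter : ℕ → ℕ → ℕ → ℕ → Set
Letter qa qb sa sb = Fin qa × Fin sa × Fin qb × Fin sb

atomHolds : ∀ {qa qb sa sb} → Atom qa qb sa sb → Letter qa qb sa sb → Set
atomHolds (atStA q) (a , _ , _ , _) = a ≡ q
atomHolds (atInA σ) (_ , x , _ , _) = x ≡ σ
atomHolds (atStB q) (_ , _ , b , _) = b ≡ q
atomHolds (atInB σ) (_ , _ , _ , y) = y ≡ σ

_,_⊨_ : ∀ {qa qb sa sb} → (ℕ → Letter qa qb sa sb) → ℕ → LTL qa qb sa sb → Set
w , t ⊨ true     = ⊤
w , t ⊨ atom a   = atomHolds a (w t)
w , t ⊨ (¬L φ)   = w , t ⊨ φ → ⊥
w , t ⊨ (φ ∧L ψ) = (w , t ⊨ φ) × (w , t ⊨ ψ)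
w , t ⊨ (φ UL ψ) = ∃ λ k → t ≤ k × (w , k ⊨ ψ) × (∀ j → t ≤ j → j < k → w , j ⊨ φ)

-- E_uncond h(A,B_1) in (A,B)^(1, suc m)   (B_1 is index zero)

module _ {qa qb sa sb : ℕ} (A : Template qa sa qa qb) (B : Template qb sb qa qb) where

  traceA,B₁ : ∀ {m} → InfRun A B (suc m) → ℕ → Letter qa qb sa sb
  traceA,B₁ r t = stA c , inA c , stB c fzero , inB c fzero
    where c = conf r t

  EUncond : (m : ℕ) → LTL qa qb sa sb → Set
  EUncond m h = Σ (InfRun A B (suc m)) λ r → UncondFair A B r × (traceA,B₁ r , 0 ⊨ h)

module Submission where

-- Let r be an unconditionally fair run of (A,B)^(1,m+1) whose (A,B₁)-trace
-- satisfies h.  We run (A,B)^(1,m+2) with the new copy acting as a shadow of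
-- B₁: it starts in init_B and, each time B₁ takes a transition, immediately
-- repeats that very transition.  This is possible because a disjunctive guard
-- of B₁ is witnessed by A or by some other B_j, and nobody but B₁ has moved in
-- between.  Every old process moves exactly when it moved in r and the shadow
-- moves right after each move of B₁, so the new run is unconditionally fair.
-- Its (A,B₁)-trace is the old trace with some letters repeated once, and
-- formulas without X cannot distinguish such stutterings.

open import Defs
open import Data.Nat using (ℕ; zero; suc; _≤_; _<_; z≤n; s≤s; _+_; _∸_; _<?_)
open import Data.Nat.Properties
open import Data.Fin using (Fin) renaming (zero to fzero; suc to fsuc)
open import Data.Fin.Subset using (_∈_)
open import Data.Product using (∃; _×_; _,_; proj₁; proj₂)
open import Data.Sum using (_⊎_; inj₁; inj₂)
open import Data.Unit using (⊤; tt)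
open import Function.Bundles using (_⇔_; mk⇔; Equivalence)
open import Relation.Binary.PropositionalEquality
open import Relation.Nullary using (yes; no; contradiction)

-- (1) Stuttering invariance of LTL without X

-- A word w' with
-- w' n = w (f n) repeats each letter of w (from f 0 on) at most twice.
StutterMap : (ℕ → ℕ) → Set
StutterMap f =
  ∀ k → f (suc k) ≡ suc (f k) ⊎ (f (suc k) ≡ f k × f (suc (suc k)) ≡ suc (f k))

module StutterMapProperties {f : ℕ → ℕ} (stutter : StutterMap f) where

  step-≤ : ∀ k → f k ≤ f (suc k)
  step-≤ k with stutter k
  ... | inj₁ advance      = subst (f k ≤_) (sym advance) (n≤1+n (f k))
  ... | inj₂ (pause , _)  = ≤-reflexive (sym pause)

  -- f never jumps: this is what makes every intermediate value attained
  step-≤1 : ∀ k → f (suc k) ≤ suc (f k)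
  step-≤1 k with stutter k
  ... | inj₁ advance      = ≤-reflexive advance
  ... | inj₂ (pause , _)  = subst (_≤ suc (f k)) (sym pause) (n≤1+n (f k))

  monotone : ∀ {i j} → i ≤ j → f i ≤ f j
  monotone {i} {zero}  z≤n = ≤-refl
  monotone {i} {suc j} i≤j with m≤n⇒m<n∨m≡n i≤j
  ... | inj₁ (s≤s i≤j′) = ≤-trans (monotone i≤j′) (step-≤ j)
  ... | inj₂ refl       = ≤-refl

  reflects-< : ∀ {i j} → f i < f j → i < j
  reflects-< {i} {j} fi<fj with i <? j
  ... | yes i<j = i<j
  ... | no  i≮j = contradiction fi<fj (≤⇒≯ (monotone (≮⇒≥ i≮j)))

  firstHit : ∀ n d → ∃ λ k → n ≤ k × f k ≡ d + f n × (∀ i → n ≤ i → i < k → f i < d + f n)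
  firstHit n zero = n , ≤-refl , refl , λ i n≤i i<n → contradiction (≤-<-trans n≤i i<n) (n≮n n)
  firstHit n (suc d) with firstHit n d
  ... | k , n≤k , fk≡ , _ with stutter k
  ...   | inj₁ advance = suc k , m≤n⇒m≤1+n n≤k , trans advance (cong suc fk≡) ,
          λ i _ i<1+k → s≤s (subst (f i ≤_) fk≡ (monotone (≤-pred i<1+k)))
  ...   | inj₂ (pause , advance) = suc (suc k) , m≤n⇒m≤1+n (m≤n⇒m≤1+n n≤k) ,
          trans advance (cong suc fk≡) ,
          λ i _ i<2+k → s≤s (subst (f i ≤_) (trans pause fk≡) (monotone (≤-pred i<2+k)))

  intermediate : ∀ n k → n ≤ k → ∀ v → f n ≤ v → v < f k → ∃ λ i → n ≤ i × i < k × f i ≡ v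
  intermediate n zero    z≤n v fn≤v v<fk = contradiction (≤-<-trans fn≤v v<fk) (n≮n (f 0))
  intermediate n (suc k) n≤1+k v fn≤v v<fk with m≤n⇒m<n∨m≡n n≤1+k
  ... | inj₂ refl = contradiction (≤-<-trans fn≤v v<fk) (n≮n _)
  ... | inj₁ (s≤s n≤k) with v <? f k
  ...   | yes v<fk = let (i , n≤i , i<k , fi≡v) = intermediate n k n≤k v fn≤v v<fk
                     in i , n≤i , m≤n⇒m≤1+n i<k , fi≡v
  ...   | no  v≮fk = k , n≤k , n<1+n k , ≤-antisym (≮⇒≥ v≮fk) (≤-pred (≤-trans v<fk (step-≤1 k)))

stutterInvariant : ∀ {qa qb sa sb} (w′ w : ℕ → Letter qa qb sa sb) (f : ℕ → ℕ) →
  StutterMap f → (∀ n → w′ n ≡ w (f n)) →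
  ∀ φ n → (w′ , n ⊨ φ) ⇔ (w , f n ⊨ φ)
stutterInvariant w′ w f stutter w′≡w∘f = inv
  where
  open StutterMapProperties stutter
  open Equivalence

  inv : ∀ φ n → (w′ , n ⊨ φ) ⇔ (w , f n ⊨ φ)
  inv true     n = mk⇔ (λ _ → tt) (λ _ → tt)
  inv (atom a) n = mk⇔ (subst (atomHolds a) (w′≡w∘f n)) (subst (atomHolds a) (sym (w′≡w∘f n)))
  inv (¬L φ)   n = mk⇔ (λ ¬φ φ′ → ¬φ (from (inv φ n) φ′)) (λ ¬φ φ′ → ¬φ (to (inv φ n) φ′))
  inv (φ ∧L ψ) n = mk⇔ (λ (p , q) → to (inv φ n) p , to (inv ψ n) q)
                       (λ (p , q) → from (inv φ n) p , from (inv ψ n) q)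
  inv (φ UL ψ) n = mk⇔ forward backward
    where
    -- positions of w between f n and f k are images of positions in [n , k)
    forward : w′ , n ⊨ (φ UL ψ) → w , f n ⊨ (φ UL ψ)
    forward (k , n≤k , ψk , φ-before) = f k , monotone n≤k , to (inv ψ k) ψk ,
      λ v fn≤v v<fk → let (i , n≤i , i<k , fi≡v) = intermediate n k n≤k v fn≤v v<fk
                      in subst (w ,_⊨ φ) fi≡v (to (inv φ i) (φ-before i n≤i i<k))

    -- the witness K of w is hit at a first position k of w′, before which f < K
    backward : w , f n ⊨ (φ UL ψ) → w′ , n ⊨ (φ UL ψ)
    backward (K , fn≤K , ψK , φ-before) with firstHit n (K ∸ f n)
    ... | k , n≤k , fk≡ , below = k , n≤k , from (inv ψ k) (subst (w ,_⊨ ψ) (sym fk≡K) ψK) ,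
          λ i n≤i i<k → from (inv φ i)
            (φ-before (f i) (monotone n≤i) (subst (f i <_) (m∸n+n≡m fn≤K) (below i n≤i i<k)))
      where
      fk≡K : f k ≡ K
      fk≡K = trans fk≡ (m∸n+n≡m fn≤K)

-- (2) Embedding (A,B)^(1,m+1) into (A,B)^(1,m+2) with a shadow of B₁

-- B-indices of the larger system: B₁ keeps index 0, the shadow takes index 1,
-- and every other old B moves up by one.
shadow : ∀ {m} → Fin (suc (suc m))
shadow = fsuc fzero

liftIdx : ∀ {m} → Fin (suc m) → Fin (suc (suc m))
liftIdx fzero    = fzero
liftIdx (fsuc j) = fsuc (fsuc j)

liftProc : ∀ {m} → Proc (suc m) → Proc (suc (suc m))
liftProc pA     = pA
liftProc (pB j) = pB (liftIdx j)

withShadow : ∀ {m} {X : Set} → (Fin (suc m) → X) → X → Fin (suc (suc m)) → X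
withShadow g x fzero            = g fzero
withShadow g x (fsuc fzero)     = x
withShadow g x (fsuc (fsuc j))  = g (fsuc j)

module Simulation {qa qb sa sb : ℕ} (A : Template qa sa qa qb) (B : Template qb sb qa qb) (m : ℕ) where

  Conf : ℕ → Set
  Conf = Config qa qb sa sb

  addShadow : Conf (suc m) → Fin qb → Fin sb → Conf (suc (suc m))
  addShadow c b σ = record { stA = stA c ; inA = inA c
                           ; stB = withShadow (stB c) b ; inB = withShadow (inB c) σ }

  twin : Conf (suc m) → Conf (suc (suc m))
  twin c = addShadow c (stB c fzero) (inB c fzero)

  lagging : Conf (suc m) → Conf (suc m) → Conf (suc (suc m))
  lagging c c′ = addShadow c′ (stB c fzero) (inB c fzero)

  -- a move of A is simulated by A; the B witnessing its guard keeps its state under liftIdx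
  simA : ∀ c c′ → Step A B c pA c′ → Step A B (twin c) pA (twin c′)
  simA c c′ ((g , tr , (j , j∈g)) , sameSt , sameIn) =
    (g , tr , (liftIdx j , witness j j∈g)) , sameSt′ , sameIn′
    where
    witness : ∀ j → stB c j ∈ proj₂ g → stB (twin c) (liftIdx j) ∈ proj₂ g
    witness fzero    x = x
    witness (fsuc j) x = x
    sameSt′ : ∀ j → stB (twin c′) j ≡ stB (twin c) j
    sameSt′ fzero           = sameSt fzero
    sameSt′ (fsuc fzero)    = sameSt fzero
    sameSt′ (fsuc (fsuc j)) = sameSt (fsuc j)
    sameIn′ : ∀ j → inB (twin c′) j ≡ inB (twin c) j
    sameIn′ fzero           = sameIn fzero
    sameIn′ (fsuc fzero)    = sameIn fzero
    sameIn′ (fsuc (fsuc j)) = sameIn (fsuc j)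

  simOtherB : ∀ c c′ i → Step A B c (pB (fsuc i)) c′ →
              Step A B (twin c) (pB (fsuc (fsuc i))) (twin c′)
  simOtherB c c′ i ((g , tr , guard) , sameStA , sameInA , sameSt , sameIn) =
    (g , tr , guard′ guard) , sameStA , sameInA , sameSt′ , sameIn′
    where
    guard′ : guardOkB A B g c (fsuc i) → guardOkB A B g (twin c) (fsuc (fsuc i))
    guard′ (inj₁ byA)                 = inj₁ byA
    guard′ (inj₂ (fzero , _ , x))     = inj₂ (fzero , (λ ()) , x)
    guard′ (inj₂ (fsuc j , j≢i , x))  = inj₂ (fsuc (fsuc j) , (λ { refl → j≢i refl }) , x)
    sameSt′ : ∀ j → j ≢ fsuc (fsuc i) → stB (twin c′) j ≡ stB (twin c) j
    sameSt′ fzero           _   = sameSt fzero (λ ())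
    sameSt′ (fsuc fzero)    _   = sameSt fzero (λ ())
    sameSt′ (fsuc (fsuc j)) j≢i = sameSt (fsuc j) (λ { refl → j≢i refl })
    sameIn′ : ∀ j → j ≢ fsuc (fsuc i) → inB (twin c′) j ≡ inB (twin c) j
    sameIn′ fzero           _   = sameIn fzero (λ ())
    sameIn′ (fsuc fzero)    _   = sameIn fzero (λ ())
    sameIn′ (fsuc (fsuc j)) j≢i = sameIn (fsuc j) (λ { refl → j≢i refl })

  simB₁ : ∀ c c′ → Step A B c (pB fzero) c′ → Step A B (twin c) (pB fzero) (lagging c c′)
  simB₁ c c′ ((g , tr , guard) , sameStA , sameInA , sameSt , sameIn) =
    (g , tr , guard′ guard) , sameStA , sameInA , sameSt′ , sameIn′
    where
    guard′ : guardOkB A B g c fzero → guardOkB A B g (twin c) fzero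
    guard′ (inj₁ byA)              = inj₁ byA
    guard′ (inj₂ (fzero , j≢0 , _)) = contradiction refl j≢0
    guard′ (inj₂ (fsuc j , _ , x))  = inj₂ (fsuc (fsuc j) , (λ ()) , x)
    sameSt′ : ∀ j → j ≢ fzero → stB (lagging c c′) j ≡ stB (twin c) j
    sameSt′ fzero           j≢0 = contradiction refl j≢0
    sameSt′ (fsuc fzero)    _   = refl
    sameSt′ (fsuc (fsuc j)) _   = sameSt (fsuc j) (λ ())
    sameIn′ : ∀ j → j ≢ fzero → inB (lagging c c′) j ≡ inB (twin c) j
    sameIn′ fzero           j≢0 = contradiction refl j≢0
    sameIn′ (fsuc fzero)    _   = refl
    sameIn′ (fsuc (fsuc j)) _   = sameIn (fsuc j) (λ ())

  -- the shadow repeats B₁'s transition; its guard still holds because its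
  -- witness (A or some B_j, j ≠ 1) did not move during B₁'s step
  catchUp : ∀ c c′ → Step A B c (pB fzero) c′ → Step A B (lagging c c′) (pB shadow) (twin c′)
  catchUp c c′ ((g , tr , guard) , sameStA , sameInA , sameSt , sameIn) =
    (g , tr , guard′ guard) , refl , refl , sameSt′ , sameIn′
    where
    guard′ : guardOkB A B g c fzero → guardOkB A B g (lagging c c′) shadow
    guard′ (inj₁ byA)               = inj₁ (subst (_∈ proj₁ g) (sym sameStA) byA)
    guard′ (inj₂ (fzero , j≢0 , _)) = contradiction refl j≢0
    guard′ (inj₂ (fsuc j , _ , x))  =
      inj₂ (fsuc (fsuc j) , (λ ()) , subst (_∈ proj₂ g) (sym (sameSt (fsuc j) (λ ()))) x)
    sameSt′ : ∀ j → j ≢ shadow → stB (twin c′) j ≡ stB (lagging c c′) j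
    sameSt′ fzero           _   = refl
    sameSt′ (fsuc fzero)    j≢1 = contradiction refl j≢1
    sameSt′ (fsuc (fsuc j)) _   = refl
    sameIn′ : ∀ j → j ≢ shadow → inB (twin c′) j ≡ inB (lagging c c′) j
    sameIn′ fzero           _   = refl
    sameIn′ (fsuc fzero)    j≢1 = contradiction refl j≢1
    sameIn′ (fsuc (fsuc j)) _   = refl

-- (3) The shadow run

-- Whether, at the current position, the shadow agrees with B₁ or still has
-- to repeat B₁'s last transition.
data Phase : Set where
  inSync lagBehind : Phase

phaseAfter : ∀ {m} → Proc (suc m) → Phase
phaseAfter pA              = inSync
phaseAfter (pB fzero)      = lagBehind
phaseAfter (pB (fsuc _))   = inSync

module ShadowRun {qa qb sa sb : ℕ} (A : Template qa sa qa qb) (B : Template qb sb qa qb) (m : ℕ)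
                 (r : InfRun A B (suc m)) where
  open Simulation A B m

  -- (t , inSync): twin of r's t-th configuration;
  -- (t , lagBehind): B₁ has done r's t-th step, the shadow has not
  Pos : Set
  Pos = ℕ × Phase

  afterStep : ℕ → Phase → Pos
  afterStep t inSync    = suc t , inSync
  afterStep t lagBehind = t , lagBehind

  next : Pos → Pos
  next (t , inSync)    = afterStep t (phaseAfter (mover r t))
  next (t , lagBehind) = suc t , inSync

  pos : ℕ → Pos
  pos zero    = 0 , inSync
  pos (suc n) = next (pos n)

  confAt : Pos → Conf (suc (suc m))
  confAt (t , inSync)    = twin (conf r t)
  confAt (t , lagBehind) = lagging (conf r t) (conf r (suc t))

  moverAt : Pos → Proc (suc (suc m))
  moverAt (t , inSync)    = liftProc (mover r t)
  moverAt (t , lagBehind) = pB shadow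

  WellFormed : Pos → Set
  WellFormed (t , inSync)    = ⊤
  WellFormed (t , lagBehind) = mover r t ≡ pB fzero

  wellFormed : ∀ n → WellFormed (pos n)
  wellFormed zero    = tt
  wellFormed (suc n) = nextWellFormed (pos n)
    where
    nextWellFormed : ∀ p → WellFormed (next p)
    nextWellFormed (t , inSync) with mover r t in moved
    ... | pA          = tt
    ... | pB fzero    = moved
    ... | pB (fsuc _) = tt
    nextWellFormed (t , lagBehind) = tt

  stepAt : ∀ p → WellFormed p → Step A B (confAt p) (moverAt p) (confAt (next p))
  stepAt (t , inSync) _ with mover r t | steps r t
  ... | pA          | s = simA (conf r t) (conf r (suc t)) s
  ... | pB fzero    | s = simB₁ (conf r t) (conf r (suc t)) s
  ... | pB (fsuc i) | s = simOtherB (conf r t) (conf r (suc t)) i s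
  stepAt (t , lagBehind) movedB₁ =
    catchUp (conf r t) (conf r (suc t)) (subst (λ p → Step A B (conf r t) p (conf r (suc t))) movedB₁ (steps r t))

  shadowRun : InfRun A B (suc (suc m))
  shadowRun = record
    { conf  = λ n → confAt (pos n)
    ; mover = λ n → moverAt (pos n)
    ; start = proj₁ (start r) , startB
    ; steps = λ n → stepAt (pos n) (wellFormed n)
    }
    where
    startB : ∀ j → stB (confAt (pos 0)) j ≡ init B
    startB fzero           = proj₂ (start r) fzero
    startB (fsuc fzero)    = proj₂ (start r) fzero
    startB (fsuc (fsuc j)) = proj₂ (start r) (fsuc j)

  -- the step of r whose (A,B₁)-letter is shown at a position
  clock : Pos → ℕ
  clock (t , inSync)    = t
  clock (t , lagBehind) = suc t

  clockAfterStep : ∀ t ph → clock (afterStep t ph) ≡ suc t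
  clockAfterStep t inSync    = refl
  clockAfterStep t lagBehind = refl

  clockStutters : StutterMap (λ n → clock (pos n))
  clockStutters k = clockNext (pos k)
    where
    clockNext : ∀ p → clock (next p) ≡ suc (clock p)
                    ⊎ (clock (next p) ≡ clock p × clock (next (next p)) ≡ suc (clock p))
    clockNext (t , inSync)    = inj₁ (clockAfterStep t (phaseAfter (mover r t)))
    clockNext (t , lagBehind) = inj₂ (refl , clockAfterStep (suc t) (phaseAfter (mover r (suc t))))

  traceEq : ∀ n → traceA,B₁ A B shadowRun n ≡ traceA,B₁ A B r (clock (pos n))
  traceEq n = letterAt (pos n)
    where
    letterAt : ∀ p → (stA (confAt p) , inA (confAt p) , stB (confAt p) fzero , inB (confAt p) fzero)
                     ≡ traceA,B₁ A B r (clock p)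
    letterAt (t , inSync)    = refl
    letterAt (t , lagBehind) = refl

  open StutterMapProperties clockStutters using (reflects-<)

  reachSynced : ∀ t → ∃ λ n → pos n ≡ (t , inSync)
  reachSynced zero    = 0 , refl
  reachSynced (suc t) with reachSynced t | phaseAfter (mover r t) in phase
  ... | n , pos≡ | inSync    = suc n , trans (cong next pos≡) (cong (afterStep t) phase)
  ... | n , pos≡ | lagBehind = suc (suc n) ,
        trans (cong (λ p → next (next p)) pos≡) (cong (λ ph → next (afterStep t ph)) phase)

  movesAgain : UncondFair A B r → ∀ q N →
               ∃ λ n → N ≤ n × ∃ λ t → pos n ≡ (t , inSync) × mover r t ≡ q
  movesAgain fair q N with fair q (suc (clock (pos N)))
  ... | t , late , moves with reachSynced t
  ...   | n , pos≡ = n , <⇒≤ (reflects-< (subst (clock (pos N) <_) (sym (cong clock pos≡)) late)) ,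
                     t , pos≡ , moves

  oldMoves : UncondFair A B r → ∀ q N → ∃ λ n → N ≤ n × moverAt (pos n) ≡ liftProc q
  oldMoves fair q N with movesAgain fair q N
  ... | n , N≤n , t , pos≡ , moves = n , N≤n , trans (cong moverAt pos≡) (cong liftProc moves)

  shadowMoves : UncondFair A B r → ∀ N → ∃ λ n → N ≤ n × moverAt (pos n) ≡ pB shadow
  shadowMoves fair N with movesAgain fair (pB fzero) N
  ... | n , N≤n , t , pos≡ , moves = suc n , m≤n⇒m≤1+n N≤n ,
        cong moverAt (trans (cong next pos≡) (cong (λ p → afterStep t (phaseAfter p)) moves))

  shadowFair : UncondFair A B r → UncondFair A B shadowRun
  shadowFair fair pA                   = oldMoves fair pA
  shadowFair fair (pB fzero)           = oldMoves fair (pB fzero)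
  shadowFair fair (pB (fsuc fzero))    = shadowMoves fair
  shadowFair fair (pB (fsuc (fsuc j))) = oldMoves fair (pB (fsuc j))

mainTheorem7 : {qa qb sa sb : ℕ} (A : Template qa sa qa qb) (B : Template qb sb qa qb)
    (h : LTL qa qb sa sb) (m : ℕ) →
    EUncond A B m h → EUncond A B (suc m) h
mainTheorem7 A B h m (r , fair , sat) =
  shadowRun , shadowFair fair ,
  Equivalence.from (stutterInvariant _ _ _ clockStutters traceEq h 0) sat
  where open ShadowRun A B m r
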